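{- Let $R$ be a finite Abelian group endowed with a binary operation $\circ:R\times R\to R$ that is distributive over addition on both sides (a possibly non-associative ring). Let $R\star R$ denote the set $R\times R$ with the group operation $(x,y)\star(x',y')=(x+x',\,y+y'+x\circ x')$, and let $U(R)$ be the set of all $a\in R$ such that the map $R\to R$, $x\mapsto x\circ a$, is bijective. Then the set $B=\{(x,x\circ x):x\in R\}$ is a difference basis for the set $U(R)\times R$ in the group $R\star R$, i.e. every $g\in U(R)\times R$ can be written as $g=b_1\star b_2^{ -1}$ with $b_1,b_2\in B$.
   Context: In the group $R\star R$ the identity is $(0,0)$ and the inverse of $(x,y)$ is $(-x,-y+x\circ x)$. -}

module Defs where

open import Level using (Level; _⊔_)
open import Data.Nat using (ℕ)
open import Data.Fin using (Fin)
open import Data.Product using (_×_; _,_; Σ; ∃)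
open import Algebra.Bundles using (AbelianGroup)
open import Algebra.Core using (Op₂)
open import Algebra.Definitions using (_DistributesOverˡ_; _DistributesOverʳ_; Congruent₂)
open import Function.Bundles using (Inverse)
open import Function.Definitions using (Bijective)
open import Relation.Binary.PropositionalEquality as P using (_≡_)

record NARing {c ℓ : Level} (A : AbelianGroup c ℓ) : Set (c ⊔ ℓ) where
  open AbelianGroup A
  field
    _∘_       : Op₂ Carrier
    ∘-cong    : Congruent₂ _≈_ _∘_
    distribˡ  : _DistributesOverˡ_ _≈_ _∘_ _∙_
    distribʳ  : _DistributesOverʳ_ _≈_ _∘_ _∙_

IsFinite : {c ℓ : Level} → AbelianGroup c ℓ → Set (c ⊔ ℓ)
IsFinite A = ∃ λ (n : ℕ) → Inverse (P.setoid (Fin n)) (AbelianGroup.setoid A)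

module RStarR {c ℓ : Level} (A : AbelianGroup c ℓ) (R : NARing A) where
  open AbelianGroup A renaming (_∙_ to _+_; _⁻¹ to -_; ε to 0#)
  open NARing R

  _≈²_ : Carrier × Carrier → Carrier × Carrier → Set ℓ
  (x , y) ≈² (x' , y') = (x ≈ x') × (y ≈ y')

  _⋆_ : Carrier × Carrier → Carrier × Carrier → Carrier × Carrier
  (x , y) ⋆ (x' , y') = (x + x') , ((y + y') + (x ∘ x'))

  inv⋆ : Carrier × Carrier → Carrier × Carrier
  inv⋆ (x , y) = (- x) , ((- y) + (x ∘ x))

  U : Carrier → Set (c ⊔ ℓ)
  U a = Bijective _≈_ _≈_ (λ x → x ∘ a)

  InB : Carrier × Carrier → Set (c ⊔ ℓ)
  InB b = Σ Carrier λ x → b ≈² (x , (x ∘ x))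

module Submission where

open import Defs
open import Level using (Level)
open import Data.Product using (_×_; _,_; Σ; proj₁; proj₂)
open import Algebra.Bundles using (AbelianGroup)
import Algebra.Properties.AbelianGroup as AbelianGroupProperties
import Relation.Binary.Reasoning.Setoid as SetoidReasoning

-- Proof idea: the ⋆-quotient of two elements of B is
--   (x , x∘x) ⋆ (z , z∘z)⁻¹ = (x - z , x ∘ (x - z)).
-- Given (u , y) with u ∈ U(R), choose x with x ∘ u = y and put z = x - u.

module _ {c ℓ : Level} (A : AbelianGroup c ℓ) (R : NARing A) where
  open AbelianGroup A renaming (_∙_ to _+_; _⁻¹ to -_; ε to 0#)
  open AbelianGroupProperties A using (⁻¹-anti-homo‿-; xyx⁻¹≈y)
  open NARing R
  open RStarR A R
  open SetoidReasoning setoid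

  x-[x-y]≈y : ∀ x y → x - (x - y) ≈ y
  x-[x-y]≈y x y = begin
    x - (x - y)    ≈⟨ ∙-congˡ (⁻¹-anti-homo‿- x y) ⟩
    x + (y - x)    ≈⟨ assoc x y (- x) ⟨
    x + y - x      ≈⟨ xyx⁻¹≈y x y ⟩
    y              ∎

  square⋆square⁻¹ : ∀ x z →
    ((x , x ∘ x) ⋆ inv⋆ (z , z ∘ z)) ≈² (x - z , x ∘ (x - z))
  square⋆square⁻¹ x z = refl , (begin
    x ∘ x + (- (z ∘ z) + z ∘ z) + x ∘ (- z)  ≈⟨ ∙-congʳ (∙-congˡ (inverseˡ (z ∘ z))) ⟩
    x ∘ x + 0# + x ∘ (- z)                    ≈⟨ ∙-congʳ (identityʳ (x ∘ x)) ⟩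
    x ∘ x + x ∘ (- z)                         ≈⟨ distribˡ x x (- z) ⟨
    x ∘ (x - z)                               ∎)

  squares-difference-basis : ∀ u y → U u →
    Σ (Carrier × Carrier) λ b₁ → Σ (Carrier × Carrier) λ b₂ →
      InB b₁ × InB b₂ × ((u , y) ≈² (b₁ ⋆ inv⋆ b₂))
  squares-difference-basis u y (_ , surjective) =
    (x , x ∘ x) , (z , z ∘ z) , (x , refl , refl) , (z , refl , refl) ,
    (u≈x-z , y≈x∘[x-z])
    where
      x : Carrier
      x = proj₁ (surjective y)

      z : Carrier
      z = x - u

      u≈x-z : u ≈ x - z
      u≈x-z = sym (x-[x-y]≈y x u)

      y≈x∘[x-z] : y ≈ x ∘ x + (- (z ∘ z) + z ∘ z) + x ∘ (- z)
      y≈x∘[x-z] = begin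
        y            ≈⟨ proj₂ (surjective y) refl ⟨
        x ∘ u        ≈⟨ ∘-cong refl u≈x-z ⟩
        x ∘ (x - z)  ≈⟨ proj₂ (square⋆square⁻¹ x z) ⟨
        x ∘ x + (- (z ∘ z) + z ∘ z) + x ∘ (- z)  ∎

theorem5p4 : {c ℓ : Level} (A : AbelianGroup c ℓ) (R : NARing A) → IsFinite A →
    let open AbelianGroup A using (Carrier) in
    let open RStarR A R in
    ∀ (u y : Carrier) → U u →
    Σ (Carrier × Carrier) λ b₁ → Σ (Carrier × Carrier) λ b₂ →
    InB b₁ × InB b₂ × ((u , y) ≈² (b₁ ⋆ inv⋆ b₂))
theorem5p4 A R _ = squares-difference-basis A R
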